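{- Let $H$ be a subset of $[n]$ of cardinality $k-2$, and let $a,b,c,d$ be cyclically ordered elements of $[n]\setminus H$. Let $J$ be a $k$-element subset of $[n]$. If $H\cup\{a,c\}$ and $H\cup\{b,d\}$ are each weakly separated from $J$, then $H\cup\{a,b\}$, $H\cup\{b,c\}$, $H\cup\{c,d\}$ and $H\cup\{d,a\}$ are each weakly separated from $J$.
   Context: $[n]=\{1,\dots,n\}$ is considered cyclically ordered, with $1\le k\le n$ fixed; elements $i_1,\dots,i_r$ are cyclically ordered if $i_s<i_{s+1}<\cdots<i_r<i_1<\cdots<i_{s-1}$ for some $s$. Two $k$-element sets $I,J\subseteq[n]$ are weakly separated if there do not exist cyclically ordered $a,b,c,d$ with $a,c\in I\setminus J$ and $b,d\in J\setminus I$. -}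

module Defs where

open import Data.Nat using (ℕ; _≤_)
open import Data.Fin using (Fin; _<_)
open import Data.Fin.Subset using (Subset; _∈_; _∉_; ∣_∣; _∪_; ⁅_⁆)
open import Data.Product using (_×_; ∃-syntax)
open import Data.Sum using (_⊎_)
open import Relation.Nullary using (¬_)
open import Relation.Binary.PropositionalEquality using (_≡_)

Increasing4 : ∀ {n} → Fin n → Fin n → Fin n → Fin n → Set
Increasing4 a b c d = (a < b) × (b < c) × (c < d)

CyclicallyOrdered4 : ∀ {n} → Fin n → Fin n → Fin n → Fin n → Set
CyclicallyOrdered4 a b c d =
  Increasing4 a b c d ⊎ Increasing4 b c d a ⊎ Increasing4 c d a b ⊎ Increasing4 d a b c

_∈_∖_ : ∀ {n} → Fin n → Subset n → Subset n → Set
x ∈ I ∖ J = (x ∈ I) × (x ∉ J)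

-- Weak separation of two subsets of [n] (the paper applies it to k-element sets).
WeaklySeparated : ∀ {n} → Subset n → Subset n → Set
WeaklySeparated {n} I J =
  ¬ (∃[ a ] ∃[ b ] ∃[ c ] ∃[ d ]
       (CyclicallyOrdered4 a b c d × a ∈ I ∖ J × c ∈ I ∖ J × b ∈ J ∖ I × d ∈ J ∖ I))

_⊕_,_ : ∀ {n} → Subset n → Fin n → Fin n → Subset n
H ⊕ x , y = H ∪ (⁅ x ⁆ ∪ ⁅ y ⁆)

-- An alternation p q r s between Iab = H ∪ {a,b} and J (p, r ∈ Iab ∖ J, q, s ∈ J ∖ Iab)
-- is also one between Iac = H ∪ {a,c} and J unless it passes through b or c, and one
-- between Ibd = H ∪ {b,d} and J unless it passes through a or d; so it passes through a
-- point of each pair. The remaining configurations are excluded in two ways. An element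
-- of H ∖ J, or of J ∖ (H ∪ {a,b,c,d}), lies on one side or the other of a suitable chord,
-- and either side yields an alternation for Iac or Ibd; and once those elements are ruled
-- out, one of Iac, Ibd violates |I ∖ J| = |J ∖ I|, which holds because |Iac| = |Ibd| = |J|.
module Submission where

open import Defs
open import Data.Nat using (ℕ; suc; _+_; _≤_; s≤s)
open import Data.Nat.Properties using (+-comm; +-suc; +-monoʳ-≤; +-cancelˡ-≤; module ≤-Reasoning)
open import Data.Fin using (Fin; zero; suc; _<_; _≟_)
open import Data.Fin.Properties using (<-trans; <-asym; <-irrefl; <-cmp)
open import Data.Fin.Subset using (Subset; _∈_; _∉_; _⊆_; ∣_∣; _∪_; _─_; ⁅_⁆; inside; outside)
open import Data.Fin.Subset.Properties
open import Data.Vec.Base using (_∷_; []; here; there)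
open import Data.Product using (_×_; _,_; proj₁; proj₂)
open import Data.Sum using (_⊎_; inj₁; inj₂; [_,_]′)
open import Data.Empty using (⊥; ⊥-elim)
open import Function using (_∘_)
open import Relation.Nullary using (¬_; Dec; yes; no)
open import Relation.Binary.Definitions using (tri<; tri≈; tri>)
open import Relation.Binary.PropositionalEquality
  using (_≡_; _≢_; refl; sym; trans; cong; subst; ≢-sym; module ≡-Reasoning)

private
  variable
    n : ℕ
    H I J I₁ J₁ I₂ J₂ : Subset n
    a b c d u v w m m′ p q r s x y z : Fin n

Cyc₃ : Fin n → Fin n → Fin n → Set
Cyc₃ x y z = (x < y × y < z) ⊎ (y < z × z < x) ⊎ (z < x × x < y)

cyc₃-rotate : Cyc₃ x y z → Cyc₃ y z x
cyc₃-rotate (inj₁ p)        = inj₂ (inj₂ p)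
cyc₃-rotate (inj₂ (inj₁ p)) = inj₁ p
cyc₃-rotate (inj₂ (inj₂ p)) = inj₂ (inj₁ p)

cyc₃-asym : Cyc₃ x y z → ¬ Cyc₃ x z y
cyc₃-asym (inj₁ (_ , y<z))        (inj₁ (_ , z<y))        = <-asym y<z z<y
cyc₃-asym (inj₁ (_ , y<z))        (inj₂ (inj₁ (z<y , _))) = <-asym y<z z<y
cyc₃-asym (inj₁ (x<y , _))        (inj₂ (inj₂ (y<x , _))) = <-asym x<y y<x
cyc₃-asym (inj₂ (inj₁ (y<z , _))) (inj₁ (_ , z<y))        = <-asym y<z z<y
cyc₃-asym (inj₂ (inj₁ (y<z , _))) (inj₂ (inj₁ (z<y , _))) = <-asym y<z z<y
cyc₃-asym (inj₂ (inj₁ (_ , z<x))) (inj₂ (inj₂ (_ , x<z))) = <-asym z<x x<z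
cyc₃-asym (inj₂ (inj₂ (z<x , _))) (inj₁ (x<z , _))        = <-asym z<x x<z
cyc₃-asym (inj₂ (inj₂ (_ , x<y))) (inj₂ (inj₁ (_ , y<x))) = <-asym x<y y<x
cyc₃-asym (inj₂ (inj₂ (_ , x<y))) (inj₂ (inj₂ (y<x , _))) = <-asym x<y y<x

cyc₃⇒≢ : Cyc₃ x y z → x ≢ y
cyc₃⇒≢ (inj₁ (x<x , _))        refl = <-irrefl refl x<x
cyc₃⇒≢ (inj₂ (inj₁ (x<z , z<x))) refl = <-asym x<z z<x
cyc₃⇒≢ (inj₂ (inj₂ (_ , x<x))) refl = <-irrefl refl x<x

cyc₃-total : x ≢ y → y ≢ z → x ≢ z → Cyc₃ x y z ⊎ Cyc₃ x z y
cyc₃-total {x = x} {y} {z} x≢y y≢z x≢z with <-cmp x y | <-cmp y z | <-cmp x z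
... | tri≈ _ x≡y _ | _            | _            = ⊥-elim (x≢y x≡y)
... | _            | tri≈ _ y≡z _ | _            = ⊥-elim (y≢z y≡z)
... | _            | _            | tri≈ _ x≡z _ = ⊥-elim (x≢z x≡z)
... | tri< x<y _ _ | tri< y<z _ _ | _            = inj₁ (inj₁ (x<y , y<z))
... | tri< x<y _ _ | tri> _ _ z<y | tri< x<z _ _ = inj₂ (inj₁ (x<z , z<y))
... | tri< x<y _ _ | tri> _ _ z<y | tri> _ _ z<x = inj₁ (inj₂ (inj₂ (z<x , x<y)))
... | tri> _ _ y<x | tri< y<z _ _ | tri< x<z _ _ = inj₂ (inj₂ (inj₂ (y<x , x<z)))
... | tri> _ _ y<x | tri< y<z _ _ | tri> _ _ z<x = inj₁ (inj₂ (inj₁ (y<z , z<x)))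
... | tri> _ _ y<x | tri> _ _ z<y | _            = inj₂ (inj₂ (inj₁ (z<y , y<x)))

cyc₄-rotate : CyclicallyOrdered4 a b c d → CyclicallyOrdered4 b c d a
cyc₄-rotate (inj₁ p)               = inj₂ (inj₂ (inj₂ p))
cyc₄-rotate (inj₂ (inj₁ p))        = inj₁ p
cyc₄-rotate (inj₂ (inj₂ (inj₁ p))) = inj₂ (inj₁ p)
cyc₄-rotate (inj₂ (inj₂ (inj₂ p))) = inj₂ (inj₂ (inj₁ p))

cyc₄⇒cyc₃ : CyclicallyOrdered4 a b c d → Cyc₃ a b c
cyc₄⇒cyc₃ (inj₁ (a<b , b<c , _))               = inj₁ (a<b , b<c)
cyc₄⇒cyc₃ (inj₂ (inj₁ (b<c , c<d , d<a)))      = inj₂ (inj₁ (b<c , <-trans c<d d<a))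
cyc₄⇒cyc₃ (inj₂ (inj₂ (inj₁ (c<d , d<a , a<b)))) = inj₂ (inj₂ (<-trans c<d d<a , a<b))
cyc₄⇒cyc₃ (inj₂ (inj₂ (inj₂ (_ , a<b , b<c)))) = inj₁ (a<b , b<c)

cyc₃⇒cyc₄ : Cyc₃ a b c → Cyc₃ a c d → CyclicallyOrdered4 a b c d
cyc₃⇒cyc₄ (inj₁ (a<b , b<c))        (inj₁ (_ , c<d))          = inj₁ (a<b , b<c , c<d)
cyc₃⇒cyc₄ (inj₁ (a<b , b<c))        (inj₂ (inj₁ (c<d , d<a))) =
  ⊥-elim (<-asym (<-trans a<b b<c) (<-trans c<d d<a))
cyc₃⇒cyc₄ (inj₁ (a<b , b<c))        (inj₂ (inj₂ (d<a , _)))   = inj₂ (inj₂ (inj₂ (d<a , a<b , b<c)))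
cyc₃⇒cyc₄ (inj₂ (inj₁ (_ , c<a)))   (inj₁ (a<c , _))          = ⊥-elim (<-asym c<a a<c)
cyc₃⇒cyc₄ (inj₂ (inj₁ (b<c , _)))   (inj₂ (inj₁ (c<d , d<a))) = inj₂ (inj₁ (b<c , c<d , d<a))
cyc₃⇒cyc₄ (inj₂ (inj₁ (_ , c<a)))   (inj₂ (inj₂ (_ , a<c)))   = ⊥-elim (<-asym c<a a<c)
cyc₃⇒cyc₄ (inj₂ (inj₂ (c<a , _)))   (inj₁ (a<c , _))          = ⊥-elim (<-asym c<a a<c)
cyc₃⇒cyc₄ (inj₂ (inj₂ (c<a , a<b))) (inj₂ (inj₁ (c<d , d<a))) = inj₂ (inj₂ (inj₁ (c<d , d<a , a<b)))
cyc₃⇒cyc₄ (inj₂ (inj₂ (c<a , _)))   (inj₂ (inj₂ (_ , a<c)))   = ⊥-elim (<-asym c<a a<c)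

cyc₃-rotate⁻¹ : Cyc₃ x y z → Cyc₃ z x y
cyc₃-rotate⁻¹ h = cyc₃-rotate (cyc₃-rotate h)

cyc₄-rotate² : CyclicallyOrdered4 a b c d → CyclicallyOrdered4 c d a b
cyc₄-rotate² h = cyc₄-rotate (cyc₄-rotate h)

cyc₄-rotate⁻¹ : CyclicallyOrdered4 a b c d → CyclicallyOrdered4 d a b c
cyc₄-rotate⁻¹ h = cyc₄-rotate (cyc₄-rotate² h)

cyc₄-bcd : CyclicallyOrdered4 a b c d → Cyc₃ b c d
cyc₄-bcd h = cyc₄⇒cyc₃ (cyc₄-rotate h)

cyc₄-abd : CyclicallyOrdered4 a b c d → Cyc₃ a b d
cyc₄-abd h = cyc₃-rotate (cyc₄⇒cyc₃ (cyc₄-rotate⁻¹ h))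

cyc₄-acd : CyclicallyOrdered4 a b c d → Cyc₃ a c d
cyc₄-acd h = cyc₃-rotate⁻¹ (cyc₄-bcd (cyc₄-rotate h))

cyc₃-trans : Cyc₃ a b c → Cyc₃ a c d → Cyc₃ a b d
cyc₃-trans abc acd = cyc₄-abd (cyc₃⇒cyc₄ abc acd)

∈⊕-base : z ∈ H → z ∈ H ⊕ x , y
∈⊕-base z∈H = x∈p∪q⁺ (inj₁ z∈H)

∈⊕-left : x ∈ H ⊕ x , y
∈⊕-left {x = x} = x∈p∪q⁺ (inj₂ (x∈p∪q⁺ (inj₁ (x∈⁅x⁆ x))))

∈⊕-right : y ∈ H ⊕ x , y
∈⊕-right {y = y} = x∈p∪q⁺ (inj₂ (x∈p∪q⁺ (inj₂ (x∈⁅x⁆ y))))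

∈⊕⁻ : z ∈ H ⊕ x , y → z ∈ H ⊎ z ≡ x ⊎ z ≡ y
∈⊕⁻ {H = H} {x = x} {y} z∈ with x∈p∪q⁻ H _ z∈
... | inj₁ z∈H = inj₁ z∈H
... | inj₂ z∈xy with x∈p∪q⁻ ⁅ x ⁆ ⁅ y ⁆ z∈xy
...   | inj₁ z∈x = inj₂ (inj₁ (x∈⁅y⁆⇒x≡y x z∈x))
...   | inj₂ z∈y = inj₂ (inj₂ (x∈⁅y⁆⇒x≡y y z∈y))

∉⊕⁺ : z ∉ H → z ≢ x → z ≢ y → z ∉ H ⊕ x , y
∉⊕⁺ z∉H z≢x z≢y z∈ with ∈⊕⁻ z∈
... | inj₁ z∈H        = z∉H z∈H
... | inj₂ (inj₁ z≡x) = z≢x z≡x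
... | inj₂ (inj₂ z≡y) = z≢y z≡y

∉⊕⁻ : z ∉ H ⊕ x , y → z ∉ H × z ≢ x × z ≢ y
∉⊕⁻ z∉ = z∉ ∘ ∈⊕-base , (λ { refl → z∉ ∈⊕-left }) , (λ { refl → z∉ ∈⊕-right })

⊕-comm : ∀ (H : Subset n) x y → H ⊕ x , y ≡ H ⊕ y , x
⊕-comm H x y = cong (H ∪_) (∪-comm ⁅ x ⁆ ⁅ y ⁆)

∈⊕-replace : z ∈ H ⊕ x , y → z ≢ y → z ∈ H ⊕ x , w
∈⊕-replace z∈ z≢y with ∈⊕⁻ z∈
... | inj₁ z∈H         = ∈⊕-base z∈H
... | inj₂ (inj₁ refl) = ∈⊕-left
... | inj₂ (inj₂ z≡y)  = ⊥-elim (z≢y z≡y)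

∉⊕-replace : z ∉ H ⊕ x , y → z ≢ w → z ∉ H ⊕ x , w
∉⊕-replace z∉ z≢w with ∉⊕⁻ z∉
... | z∉H , z≢x , _ = ∉⊕⁺ z∉H z≢x z≢w

∣p∪⁅x⁆∣ : ∀ (p : Subset n) x → x ∉ p → ∣ p ∪ ⁅ x ⁆ ∣ ≡ suc ∣ p ∣
∣p∪⁅x⁆∣ (outside ∷ p) zero    _   = cong suc (cong ∣_∣ (∪-identityʳ p))
∣p∪⁅x⁆∣ (inside  ∷ p) zero    x∉p = ⊥-elim (x∉p here)
∣p∪⁅x⁆∣ (outside ∷ p) (suc x) x∉p = ∣p∪⁅x⁆∣ p x (x∉p ∘ there)
∣p∪⁅x⁆∣ (inside  ∷ p) (suc x) x∉p = cong suc (∣p∪⁅x⁆∣ p x (x∉p ∘ there))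

∣⊕∣ : x ∉ H → y ∉ H → x ≢ y → ∣ H ⊕ x , y ∣ ≡ ∣ H ∣ + 2
∣⊕∣ {x = x} {H = H} {y = y} x∉H y∉H x≢y = begin
  ∣ H ∪ (⁅ x ⁆ ∪ ⁅ y ⁆) ∣ ≡⟨ cong ∣_∣ (sym (∪-assoc H ⁅ x ⁆ ⁅ y ⁆)) ⟩
  ∣ (H ∪ ⁅ x ⁆) ∪ ⁅ y ⁆ ∣ ≡⟨ ∣p∪⁅x⁆∣ (H ∪ ⁅ x ⁆) y y∉H∪x ⟩
  suc ∣ H ∪ ⁅ x ⁆ ∣       ≡⟨ cong suc (∣p∪⁅x⁆∣ H x x∉H) ⟩
  suc (suc ∣ H ∣)         ≡⟨ +-comm 2 ∣ H ∣ ⟩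
  ∣ H ∣ + 2               ∎
  where
  open ≡-Reasoning
  y∉H∪x : y ∉ H ∪ ⁅ x ⁆
  y∉H∪x y∈ with x∈p∪q⁻ H ⁅ x ⁆ y∈
  ... | inj₁ y∈H = y∉H y∈H
  ... | inj₂ y∈x = x≢y (sym (x∈⁅y⁆⇒x≡y x y∈x))

x∈p─q⇒x∉q : ∀ (p q : Subset n) → x ∈ p ─ q → x ∉ q
x∈p─q⇒x∉q (inside ∷ p) (outside ∷ q) here       ()
x∈p─q⇒x∉q (_      ∷ p) (_       ∷ q) (there x∈) (there x∈q) = x∈p─q⇒x∉q p q x∈ x∈q

∣p∣+∣q─p∣≡∣q∣+∣p─q∣ : ∀ (p q : Subset n) → ∣ p ∣ + ∣ q ─ p ∣ ≡ ∣ q ∣ + ∣ p ─ q ∣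
∣p∣+∣q─p∣≡∣q∣+∣p─q∣ []            []            = refl
∣p∣+∣q─p∣≡∣q∣+∣p─q∣ (inside  ∷ p) (inside  ∷ q) = cong suc (∣p∣+∣q─p∣≡∣q∣+∣p─q∣ p q)
∣p∣+∣q─p∣≡∣q∣+∣p─q∣ (inside  ∷ p) (outside ∷ q) =
  trans (cong suc (∣p∣+∣q─p∣≡∣q∣+∣p─q∣ p q)) (sym (+-suc ∣ q ∣ ∣ p ─ q ∣))
∣p∣+∣q─p∣≡∣q∣+∣p─q∣ (outside ∷ p) (inside  ∷ q) =
  trans (+-suc ∣ p ∣ ∣ q ─ p ∣) (cong suc (∣p∣+∣q─p∣≡∣q∣+∣p─q∣ p q))
∣p∣+∣q─p∣≡∣q∣+∣p─q∣ (outside ∷ p) (outside ∷ q) = ∣p∣+∣q─p∣≡∣q∣+∣p─q∣ p q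

∖-unique : ∣ I ∣ ≡ ∣ J ∣ → (∀ {z} → z ∈ I ∖ J → z ≡ u) → v ∈ J ∖ I → w ∈ J ∖ I → v ≡ w
∖-unique {I = I} {J = J} {u = u} {v = v} {w = w} ∣I∣≡∣J∣ I∖J⊆u (v∈J , v∉I) (w∈J , w∉I)
  with v ≟ w
... | yes v≡w = v≡w
... | no v≢w  = ⊥-elim (2≰1 (+-cancelˡ-≤ ∣ I ∣ 2 1 ∣I∣+2≤∣I∣+1))
  where
  open ≤-Reasoning
  2≰1 : ¬ 2 ≤ 1
  2≰1 (s≤s ())
  I─J⊆⁅u⁆ : I ─ J ⊆ ⁅ u ⁆
  I─J⊆⁅u⁆ z∈ rewrite I∖J⊆u (p─q⊆p I J z∈ , x∈p─q⇒x∉q I J z∈) = x∈⁅x⁆ u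
  ∣I─J∣≤1 : ∣ I ─ J ∣ ≤ 1
  ∣I─J∣≤1 = begin
    ∣ I ─ J ∣ ≤⟨ p⊆q⇒∣p∣≤∣q∣ I─J⊆⁅u⁆ ⟩
    ∣ ⁅ u ⁆ ∣ ≡⟨ ∣⁅x⁆∣≡1 u ⟩
    1         ∎
  ⁅v⁆∪⁅w⁆⊆J─I : ⁅ v ⁆ ∪ ⁅ w ⁆ ⊆ J ─ I
  ⁅v⁆∪⁅w⁆⊆J─I z∈ with x∈p∪q⁻ ⁅ v ⁆ ⁅ w ⁆ z∈
  ... | inj₁ z∈v rewrite x∈⁅y⁆⇒x≡y v z∈v = x∈p∧x∉q⇒x∈p─q v∈J v∉I
  ... | inj₂ z∈w rewrite x∈⁅y⁆⇒x≡y w z∈w = x∈p∧x∉q⇒x∈p─q w∈J w∉I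
  2≤∣J─I∣ : 2 ≤ ∣ J ─ I ∣
  2≤∣J─I∣ = begin
    2                     ≡⟨ cong suc (sym (∣⁅x⁆∣≡1 v)) ⟩
    suc ∣ ⁅ v ⁆ ∣         ≡⟨ sym (∣p∪⁅x⁆∣ ⁅ v ⁆ w (v≢w ∘ sym ∘ x∈⁅y⁆⇒x≡y v)) ⟩
    ∣ ⁅ v ⁆ ∪ ⁅ w ⁆ ∣     ≤⟨ p⊆q⇒∣p∣≤∣q∣ ⁅v⁆∪⁅w⁆⊆J─I ⟩
    ∣ J ─ I ∣             ∎
  ∣I∣+2≤∣I∣+1 : ∣ I ∣ + 2 ≤ ∣ I ∣ + 1
  ∣I∣+2≤∣I∣+1 = begin
    ∣ I ∣ + 2             ≤⟨ +-monoʳ-≤ ∣ I ∣ 2≤∣J─I∣ ⟩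
    ∣ I ∣ + ∣ J ─ I ∣     ≡⟨ ∣p∣+∣q─p∣≡∣q∣+∣p─q∣ I J ⟩
    ∣ J ∣ + ∣ I ─ J ∣     ≤⟨ +-monoʳ-≤ ∣ J ∣ ∣I─J∣≤1 ⟩
    ∣ J ∣ + 1             ≡⟨ cong (_+ 1) (sym ∣I∣≡∣J∣) ⟩
    ∣ I ∣ + 1             ∎

∈⊕⇒∈base : z ∈ H ⊕ x , y → z ≢ x → z ≢ y → z ∈ H
∈⊕⇒∈base z∈ z≢x z≢y with ∈⊕⁻ z∈
... | inj₁ z∈H        = z∈H
... | inj₂ (inj₁ z≡x) = ⊥-elim (z≢x z≡x)
... | inj₂ (inj₂ z≡y) = ⊥-elim (z≢y z≡y)

∉∈⇒≢ : x ∉ J → y ∈ J → x ≢ y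
∉∈⇒≢ x∉J y∈J refl = x∉J y∈J

¬alternation : WeaklySeparated I J → CyclicallyOrdered4 p q r s →
               p ∈ I ∖ J → q ∈ J ∖ I → r ∈ I ∖ J → s ∈ J ∖ I → ⊥
¬alternation ws pqrs p∈ q∈ r∈ s∈ = ws (_ , _ , _ , _ , pqrs , p∈ , r∈ , q∈ , s∈)

ws-sym : WeaklySeparated I J → WeaklySeparated J I
ws-sym ws (_ , _ , _ , _ , pqrs , p∈ , r∈ , q∈ , s∈) = ¬alternation ws (cyc₄-rotate pqrs) q∈ r∈ s∈ p∈

crossing⁺ : ∣ I ∣ ≡ ∣ J ∣ → WeaklySeparated I J → CyclicallyOrdered4 x m y m′ →
            x ∈ I ∖ J → m ∈ J ∖ I → y ∈ I → m′ ∈ J ∖ I →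
            (y ∈ J → ∀ {z} → z ∈ I ∖ J → z ≡ x) → ⊥
crossing⁺ {J = J} {y = y} ∣I∣≡∣J∣ ws xmym′ x∈ m∈ y∈I m′∈ I∖J⊆x with y ∈? J
... | no y∉J = ¬alternation ws xmym′ x∈ m∈ (y∈I , y∉J) m′∈
... | yes y∈J = cyc₃⇒≢ (cyc₃-rotate (cyc₄-abd xmym′)) (∖-unique ∣I∣≡∣J∣ (I∖J⊆x y∈J) m∈ m′∈)

crossing⁻ : ∣ I ∣ ≡ ∣ J ∣ → WeaklySeparated I J → CyclicallyOrdered4 x m y m′ →
            x ∈ J ∖ I → m ∈ I ∖ J → y ∉ I → m′ ∈ I ∖ J →
            (y ∉ J → ∀ {z} → z ∈ J ∖ I → z ≡ x) → ⊥
crossing⁻ {J = J} {y = y} ∣I∣≡∣J∣ ws xmym′ x∈ m∈ y∉I m′∈ J∖I⊆x with y ∈? J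
... | yes y∈J = ¬alternation ws (cyc₄-rotate xmym′) m∈ (y∈J , y∉I) m′∈ x∈
... | no y∉J = cyc₃⇒≢ (cyc₃-rotate (cyc₄-abd xmym′)) (∖-unique (sym ∣I∣≡∣J∣) (J∖I⊆x y∉J) m∈ m′∈)

-- x lies on one side of the chord m m′ and forms an alternation with whichever of u, v
-- lies on the other side.
squeeze₄ : WeaklySeparated I₁ J₁ → WeaklySeparated I₂ J₂ → CyclicallyOrdered4 u m v m′ →
           u ∈ I₁ ∖ J₁ → v ∈ I₂ ∖ J₂ →
           m ∈ J₁ ∖ I₁ → m ∈ J₂ ∖ I₂ → m′ ∈ J₁ ∖ I₁ → m′ ∈ J₂ ∖ I₂ →
           x ∈ I₁ ∖ J₁ → x ∈ I₂ ∖ J₂ → ⊥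
squeeze₄ {u = u} {m = m} {v = v} {m′ = m′} {x = x}
  ws₁ ws₂ umvm′ u∈ v∈ m∈₁@(m∈J₁ , _) m∈₂ m′∈₁@(m′∈J₁ , _) m′∈₂ x∈₁@(_ , x∉J₁) x∈₂ =
  [ x-on-v-side , x-on-u-side ]′ (cyc₃-total (≢-sym (∉∈⇒≢ x∉J₁ m∈J₁)) (∉∈⇒≢ x∉J₁ m′∈J₁) (cyc₃⇒≢ mm′u))
  where
  mm′u : Cyc₃ m m′ u
  mm′u = cyc₄-acd (cyc₄-rotate umvm′)
  x-on-v-side : Cyc₃ m x m′ → ⊥
  x-on-v-side mxm′ = ¬alternation ws₁ (cyc₄-rotate⁻¹ (cyc₃⇒cyc₄ mxm′ mm′u)) u∈ m∈₁ x∈₁ m′∈₁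
  x-on-u-side : Cyc₃ m m′ x → ⊥
  x-on-u-side mm′x = ¬alternation ws₂ (cyc₄-rotate⁻¹ (cyc₃⇒cyc₄ (cyc₃-rotate mm′x) m′mv)) v∈ m′∈₂ x∈₂ m∈₂
    where
    m′mv : Cyc₃ m′ m v
    m′mv = cyc₄-acd (cyc₄-rotate⁻¹ umvm′)

squeeze₅ : WeaklySeparated I₁ J → WeaklySeparated I₂ J → CyclicallyOrdered4 u q v m → Cyc₃ u m m′ →
           u ∈ I₁ ∖ J → q ∈ J ∖ I₁ → q ∈ J ∖ I₂ → v ∈ I₂ ∖ J → m ∈ J ∖ I₂ → m′ ∈ J ∖ I₁ →
           x ∈ I₁ ∖ J → x ∈ I₂ ∖ J → ⊥
squeeze₅ {u = u} {q = q} {m = m} {m′ = m′} {x = x}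
  ws₁ ws₂ uqvm umm′ u∈ q∈₁@(q∈J , _) q∈₂ v∈ m∈ m′∈@(m′∈J , _) x∈₁@(_ , x∉J) x∈₂ =
  [ x-on-v-side , x-on-u-side ]′ (cyc₃-total (≢-sym (∉∈⇒≢ x∉J q∈J)) (∉∈⇒≢ x∉J m′∈J) q≢m′)
  where
  uqm′ : Cyc₃ u q m′
  uqm′ = cyc₃-trans (cyc₄-abd uqvm) umm′
  qmm′ : Cyc₃ q m m′
  qmm′ = cyc₄-bcd (cyc₃⇒cyc₄ (cyc₄-abd uqvm) umm′)
  q≢m′ : q ≢ m′
  q≢m′ = ≢-sym (cyc₃⇒≢ (cyc₃-rotate⁻¹ qmm′))
  x-on-v-side : Cyc₃ q x m′ → ⊥
  x-on-v-side qxm′ = ¬alternation ws₁ (cyc₄-rotate⁻¹ (cyc₃⇒cyc₄ qxm′ (cyc₃-rotate uqm′))) u∈ q∈₁ x∈₁ m′∈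
  x-on-u-side : Cyc₃ q m′ x → ⊥
  x-on-u-side qm′x =
    ¬alternation ws₂ (cyc₄-rotate (cyc₃⇒cyc₄ (cyc₄-bcd uqvm) (cyc₃-trans qmm′ qm′x))) v∈ m∈ x∈₂ q∈₂

squeeze₅′ : WeaklySeparated I₁ J → WeaklySeparated I₂ J → CyclicallyOrdered4 u v m p → Cyc₃ u p m′ →
            u ∈ I₁ ∖ J → v ∈ I₂ ∖ J → m ∈ J ∖ I₂ → p ∈ I₁ ∖ J → p ∈ I₂ ∖ J → m′ ∈ J ∖ I₁ →
            y ∈ J ∖ I₁ → y ∈ J ∖ I₂ → ⊥
squeeze₅′ {u = u} {v = v} {m = m} {p = p} {y = y}
  ws₁ ws₂ uvmp upm′ u∈ v∈@(_ , v∉J) m∈ p∈₁@(_ , p∉J) p∈₂ m′∈ y∈₁@(y∈J , _) y∈₂ =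
  [ y-on-m-side , y-on-u-side ]′ (cyc₃-total (∉∈⇒≢ v∉J y∈J) (≢-sym (∉∈⇒≢ p∉J y∈J)) v≢p)
  where
  vmp : Cyc₃ v m p
  vmp = cyc₄-bcd uvmp
  v≢p : v ≢ p
  v≢p = ≢-sym (cyc₃⇒≢ (cyc₃-rotate⁻¹ vmp))
  y-on-m-side : Cyc₃ v y p → ⊥
  y-on-m-side vyp = ¬alternation ws₁ (cyc₃⇒cyc₄ uyp upm′) u∈ y∈₁ p∈₁ m′∈
    where
    uyp : Cyc₃ u y p
    uyp = cyc₃-rotate (cyc₃-trans (cyc₃-rotate⁻¹ (cyc₄-abd uvmp)) (cyc₃-rotate⁻¹ vyp))
  y-on-u-side : Cyc₃ v p y → ⊥
  y-on-u-side vpy = ¬alternation ws₂ (cyc₃⇒cyc₄ vmp vpy) v∈ m∈ p∈₂ y∈₂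

ws-⊕-comm : WeaklySeparated (H ⊕ x , y) J → WeaklySeparated (H ⊕ y , x) J
ws-⊕-comm {H = H} {x = x} {y = y} {J = J} = subst (λ I → WeaklySeparated I J) (⊕-comm H x y)

module Exchange {n : ℕ} (H J : Subset n) (∣H∣+2≡∣J∣ : ∣ H ∣ + 2 ≡ ∣ J ∣)
  {a b c d : Fin n} (a∉H : a ∉ H) (b∉H : b ∉ H) (c∉H : c ∉ H) (d∉H : d ∉ H)
  (abcd : CyclicallyOrdered4 a b c d)
  (wsac : WeaklySeparated (H ⊕ a , c) J) (wsbd : WeaklySeparated (H ⊕ b , d) J) where

  Iab Iac Ibd : Subset n
  Iab = H ⊕ a , b
  Iac = H ⊕ a , c
  Ibd = H ⊕ b , d

  abc : Cyc₃ a b c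
  abc = cyc₄⇒cyc₃ abcd
  abd : Cyc₃ a b d
  abd = cyc₄-abd abcd
  acd : Cyc₃ a c d
  acd = cyc₄-acd abcd
  bcd : Cyc₃ b c d
  bcd = cyc₄-bcd abcd
  bda : Cyc₃ b d a
  bda = cyc₄-acd (cyc₄-rotate abcd)
  cda : Cyc₃ c d a
  cda = cyc₄⇒cyc₃ (cyc₄-rotate² abcd)
  cdb : Cyc₃ c d b
  cdb = cyc₄-abd (cyc₄-rotate² abcd)
  cab : Cyc₃ c a b
  cab = cyc₄-acd (cyc₄-rotate² abcd)

  a≢b : a ≢ b
  a≢b = cyc₃⇒≢ abc
  a≢c : a ≢ c
  a≢c = cyc₃⇒≢ acd
  a≢d : a ≢ d
  a≢d = ≢-sym (cyc₃⇒≢ (cyc₃-rotate⁻¹ abd))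
  b≢c : b ≢ c
  b≢c = cyc₃⇒≢ bcd
  b≢d : b ≢ d
  b≢d = cyc₃⇒≢ bda
  c≢d : c ≢ d
  c≢d = cyc₃⇒≢ cda

  b∉Iac : b ∉ Iac
  b∉Iac = ∉⊕⁺ b∉H (≢-sym a≢b) b≢c
  d∉Iac : d ∉ Iac
  d∉Iac = ∉⊕⁺ d∉H (≢-sym a≢d) (≢-sym c≢d)
  a∉Ibd : a ∉ Ibd
  a∉Ibd = ∉⊕⁺ a∉H a≢b a≢d
  c∉Ibd : c ∉ Ibd
  c∉Ibd = ∉⊕⁺ c∉H (≢-sym b≢c) c≢d

  ∣Iac∣≡∣J∣ : ∣ Iac ∣ ≡ ∣ J ∣
  ∣Iac∣≡∣J∣ = trans (∣⊕∣ a∉H c∉H a≢c) ∣H∣+2≡∣J∣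
  ∣Ibd∣≡∣J∣ : ∣ Ibd ∣ ≡ ∣ J ∣
  ∣Ibd∣≡∣J∣ = trans (∣⊕∣ b∉H d∉H b≢d) ∣H∣+2≡∣J∣

  Iab∖J⇒Iac∖J : z ∈ Iab ∖ J → z ≢ b → z ∈ Iac ∖ J
  Iab∖J⇒Iac∖J (z∈ , z∉J) z≢b = ∈⊕-replace z∈ z≢b , z∉J
  Iab∖J⇒Ibd∖J : z ∈ Iab ∖ J → z ≢ a → z ∈ Ibd ∖ J
  Iab∖J⇒Ibd∖J {z} (z∈ , z∉J) z≢a = ∈⊕-replace (subst (z ∈_) (⊕-comm H a b) z∈) z≢a , z∉J
  J∖Iab⇒J∖Iac : z ∈ J ∖ Iab → z ≢ c → z ∈ J ∖ Iac
  J∖Iab⇒J∖Iac (z∈J , z∉) z≢c = z∈J , ∉⊕-replace z∉ z≢c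
  J∖Iab⇒J∖Ibd : z ∈ J ∖ Iab → z ≢ d → z ∈ J ∖ Ibd
  J∖Iab⇒J∖Ibd {z} (z∈J , z∉) z≢d = z∈J , ∉⊕-replace (subst (z ∉_) (⊕-comm H a b) z∉) z≢d

  -- The common elements are those of H ∖ J, respectively of J ∖ (H ∪ {a,b,c,d}).
  NoCommonPlus NoCommonMinus : Set
  NoCommonPlus  = ∀ {x} → x ∈ Iac ∖ J → x ∈ Ibd ∖ J → ⊥
  NoCommonMinus = ∀ {y} → y ∈ J ∖ Iac → y ∈ J ∖ Ibd → ⊥

  Iac∖J⊆⁅a⁆ : NoCommonPlus → c ∈ J → z ∈ Iac ∖ J → z ≡ a
  Iac∖J⊆⁅a⁆ noCommon c∈J (z∈ , z∉J) with ∈⊕⁻ z∈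
  ... | inj₁ z∈H         = ⊥-elim (noCommon (∈⊕-base z∈H , z∉J) (∈⊕-base z∈H , z∉J))
  ... | inj₂ (inj₁ z≡a)  = z≡a
  ... | inj₂ (inj₂ refl) = ⊥-elim (z∉J c∈J)

  Ibd∖J⊆⁅b⁆ : NoCommonPlus → d ∈ J → z ∈ Ibd ∖ J → z ≡ b
  Ibd∖J⊆⁅b⁆ noCommon d∈J (z∈ , z∉J) with ∈⊕⁻ z∈
  ... | inj₁ z∈H         = ⊥-elim (noCommon (∈⊕-base z∈H , z∉J) (∈⊕-base z∈H , z∉J))
  ... | inj₂ (inj₁ z≡b)  = z≡b
  ... | inj₂ (inj₂ refl) = ⊥-elim (z∉J d∈J)

  J∖Iac⊆⁅d⁆ : NoCommonMinus → b ∉ J → z ∈ J ∖ Iac → z ≡ d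
  J∖Iac⊆⁅d⁆ {z} noCommon b∉J (z∈J , z∉) with z ≟ d
  ... | yes z≡d = z≡d
  ... | no z≢d  = ⊥-elim (noCommon (z∈J , z∉) (z∈J , z∉Ibd))
    where z∉Ibd = ∉⊕⁺ (proj₁ (∉⊕⁻ z∉)) (≢-sym (∉∈⇒≢ b∉J z∈J)) z≢d

  J∖Ibd⊆⁅c⁆ : NoCommonMinus → a ∉ J → z ∈ J ∖ Ibd → z ≡ c
  J∖Ibd⊆⁅c⁆ {z} noCommon a∉J (z∈J , z∉) with z ≟ c
  ... | yes z≡c = z≡c
  ... | no z≢c  = ⊥-elim (noCommon (z∈J , z∉Iac) (z∈J , z∉))
    where z∉Iac = ∉⊕⁺ (proj₁ (∉⊕⁻ z∉)) (≢-sym (∉∈⇒≢ a∉J z∈J)) z≢c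

  ¬alt-aqb-c∨d : a ∉ J → b ∉ J → q ∈ J ∖ Iac → q ∈ J ∖ Ibd → Cyc₃ a q b → c ∈ J ⊎ d ∈ J → ⊥
  ¬alt-aqb-c∨d {q} a∉J b∉J q∈₁ q∈₂ aqb = [ c∈J-case , d∈J-case ]′
    where
    a∈ : a ∈ Iac ∖ J
    a∈ = ∈⊕-left , a∉J
    b∈ : b ∈ Ibd ∖ J
    b∈ = ∈⊕-left , b∉J
    noCommon : c ∈ J → d ∈ J → NoCommonPlus
    noCommon c∈J d∈J = squeeze₅ wsac wsbd (cyc₃⇒cyc₄ aqb abc) acd a∈ q∈₁ q∈₂ b∈ (c∈J , c∉Ibd) (d∈J , d∉Iac)
    c∈J-case : c ∈ J → ⊥
    c∈J-case c∈J = crossing⁺ ∣Ibd∣≡∣J∣ wsbd bcdq b∈ (c∈J , c∉Ibd) ∈⊕-right q∈₂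
                     λ d∈J → Ibd∖J⊆⁅b⁆ (noCommon c∈J d∈J) d∈J
      where
      bcdq : CyclicallyOrdered4 b c d q
      bcdq = cyc₃⇒cyc₄ bcd (cyc₃-trans bda (cyc₃-rotate⁻¹ aqb))
    d∈J-case : d ∈ J → ⊥
    d∈J-case d∈J = crossing⁺ ∣Iac∣≡∣J∣ wsac aqcd a∈ q∈₁ ∈⊕-right (d∈J , d∉Iac)
                     λ c∈J → Iac∖J⊆⁅a⁆ (noCommon c∈J d∈J) c∈J
      where
      aqcd : CyclicallyOrdered4 a q c d
      aqcd = cyc₃⇒cyc₄ (cyc₃-trans aqb abc) acd

  ¬alt-aqbs-outside : a ∉ J → b ∉ J → q ∈ J ∖ Iac → q ∈ J ∖ Ibd → s ∈ J ∖ Iac → s ∈ J ∖ Ibd →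
                      CyclicallyOrdered4 a q b s → ⊥
  ¬alt-aqbs-outside {q} {s} a∉J b∉J q∈₁ q∈₂ s∈₁@(s∈J , _) s∈₂ aqbs =
    [ d-on-b-side , d-on-a-side ]′ (cyc₃-total q≢d (λ { refl → proj₂ s∈₂ ∈⊕-right }) q≢s)
    where
    a∈ : a ∈ Iac ∖ J
    a∈ = ∈⊕-left , a∉J
    b∈ : b ∈ Ibd ∖ J
    b∈ = ∈⊕-left , b∉J
    noCommon : NoCommonPlus
    noCommon = squeeze₄ wsac wsbd aqbs a∈ b∈ q∈₁ q∈₂ s∈₁ s∈₂
    q≢d : q ≢ d
    q≢d refl = proj₂ q∈₂ ∈⊕-right
    q≢s : q ≢ s
    q≢s = cyc₃⇒≢ (cyc₃-rotate (cyc₄-abd aqbs))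
    d-on-b-side : Cyc₃ q d s → ⊥
    d-on-b-side qds = crossing⁺ ∣Iac∣≡∣J∣ wsac aqcs a∈ q∈₁ ∈⊕-right s∈₁ λ c∈J → Iac∖J⊆⁅a⁆ noCommon c∈J
      where
      qcd : Cyc₃ q c d
      qcd = cyc₄-bcd (cyc₃⇒cyc₄ (cyc₃-trans (cyc₄⇒cyc₃ aqbs) abc) acd)
      aqcs : CyclicallyOrdered4 a q c s
      aqcs = cyc₄-rotate⁻¹ (cyc₃⇒cyc₄ (cyc₃-trans qcd qds) (cyc₃-rotate (cyc₄-abd aqbs)))
    d-on-a-side : Cyc₃ q s d → ⊥
    d-on-a-side qsd = crossing⁺ ∣Ibd∣≡∣J∣ wsbd bsdq b∈ s∈₂ ∈⊕-right q∈₂ λ d∈J → Ibd∖J⊆⁅b⁆ noCommon d∈J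
      where
      bsdq : CyclicallyOrdered4 b s d q
      bsdq = cyc₄-rotate (cyc₃⇒cyc₄ (cyc₄-bcd aqbs) qsd)

  ¬alt-aqbs : a ∉ J → b ∉ J → q ∈ J ∖ Iab → s ∈ J ∖ Iab → CyclicallyOrdered4 a q b s → ⊥
  ¬alt-aqbs {q} {s} a∉J b∉J q∈ s∈@(s∈J , _) aqbs = by-position-of-s (s ≟ c) (s ≟ d)
    where
    aqb : Cyc₃ a q b
    aqb = cyc₄⇒cyc₃ aqbs
    q∈₁ : q ∈ J ∖ Iac
    q∈₁ = J∖Iab⇒J∖Iac q∈ λ { refl → cyc₃-asym abc aqb }
    q∈₂ : q ∈ J ∖ Ibd
    q∈₂ = J∖Iab⇒J∖Ibd q∈ λ { refl → cyc₃-asym abd aqb }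
    by-position-of-s : Dec (s ≡ c) → Dec (s ≡ d) → ⊥
    by-position-of-s (yes refl) _          = ¬alt-aqb-c∨d a∉J b∉J q∈₁ q∈₂ aqb (inj₁ s∈J)
    by-position-of-s (no _)     (yes refl) = ¬alt-aqb-c∨d a∉J b∉J q∈₁ q∈₂ aqb (inj₂ s∈J)
    by-position-of-s (no s≢c)   (no s≢d)   =
      ¬alt-aqbs-outside a∉J b∉J q∈₁ q∈₂ (J∖Iab⇒J∖Iac s∈ s≢c) (J∖Iab⇒J∖Ibd s∈ s≢d) aqbs

  ∈Iab-between-c-d⇒∈H : p ∈ Iab → Cyc₃ c p d → p ∈ H
  ∈Iab-between-c-d⇒∈H p∈Iab cpd = ∈⊕⇒∈base p∈Iab (λ { refl → cyc₃-asym cda cpd }) (λ { refl → cyc₃-asym cdb cpd })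

  ¬alt-cpd-a∨b : c ∈ J → d ∈ J → p ∈ H → p ∉ J → Cyc₃ c p d → a ∉ J ⊎ b ∉ J → ⊥
  ¬alt-cpd-a∨b {p} c∈J d∈J p∈H p∉J cpd = [ a∉J-case , b∉J-case ]′
    where
    cpda : CyclicallyOrdered4 c p d a
    cpda = cyc₃⇒cyc₄ cpd cda
    cpab : CyclicallyOrdered4 c p a b
    cpab = cyc₃⇒cyc₄ (cyc₄-abd cpda) cab
    pdab : CyclicallyOrdered4 p d a b
    pdab = cyc₃⇒cyc₄ (cyc₄-bcd cpda) (cyc₄-bcd cpab)
    p∈₁ : p ∈ Iac ∖ J
    p∈₁ = ∈⊕-base p∈H , p∉J
    p∈₂ : p ∈ Ibd ∖ J
    p∈₂ = ∈⊕-base p∈H , p∉J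
    noCommon : a ∉ J → b ∉ J → NoCommonMinus
    noCommon a∉J b∉J = squeeze₅′ wsac wsbd (cyc₄-rotate² cpab) (cyc₄-acd (cyc₄-rotate² pdab))
                         (∈⊕-left , a∉J) (∈⊕-left , b∉J) (c∈J , c∉Ibd) p∈₁ p∈₂ (d∈J , d∉Iac)
    a∉J-case : a ∉ J → ⊥
    a∉J-case a∉J = crossing⁻ ∣Iac∣≡∣J∣ wsac (cyc₄-rotate pdab) (d∈J , d∉Iac) (∈⊕-left , a∉J) b∉Iac p∈₁
                     λ b∉J → J∖Iac⊆⁅d⁆ (noCommon a∉J b∉J) b∉J
    b∉J-case : b ∉ J → ⊥
    b∉J-case b∉J = crossing⁻ ∣Ibd∣≡∣J∣ wsbd cpab (c∈J , c∉Ibd) p∈₂ a∉Ibd (∈⊕-left , b∉J)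
                     λ a∉J → J∖Ibd⊆⁅c⁆ (noCommon a∉J b∉J) a∉J

  ¬alt-cpdr-inside : c ∈ J → d ∈ J → p ∈ H → p ∉ J → r ∈ H → r ∉ J → CyclicallyOrdered4 c p d r → ⊥
  ¬alt-cpdr-inside {p} {r} c∈J d∈J p∈H p∉J r∈H r∉J cpdr =
    [ b-on-d-side , b-on-c-side ]′ (cyc₃-total (λ { refl → b∉H p∈H }) (λ { refl → b∉H r∈H }) p≢r)
    where
    p∈₁ : p ∈ Iac ∖ J
    p∈₁ = ∈⊕-base p∈H , p∉J
    p∈₂ : p ∈ Ibd ∖ J
    p∈₂ = ∈⊕-base p∈H , p∉J
    r∈₁ : r ∈ Iac ∖ J
    r∈₁ = ∈⊕-base r∈H , r∉J
    r∈₂ : r ∈ Ibd ∖ J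
    r∈₂ = ∈⊕-base r∈H , r∉J
    noCommon : NoCommonMinus
    noCommon = squeeze₄ (ws-sym wsac) (ws-sym wsbd) (cyc₄-rotate² cpdr) (d∈J , d∉Iac) (c∈J , c∉Ibd) r∈₁ r∈₂ p∈₁ p∈₂
    p≢r : p ≢ r
    p≢r = cyc₃⇒≢ (cyc₄-acd (cyc₄-rotate cpdr))
    b-on-d-side : Cyc₃ p b r → ⊥
    b-on-d-side pbr = crossing⁻ ∣Ibd∣≡∣J∣ wsbd cpar (c∈J , c∉Ibd) p∈₂ a∉Ibd r∈₂ λ a∉J → J∖Ibd⊆⁅c⁆ noCommon a∉J
      where
      pab : Cyc₃ p a b
      pab = cyc₄-bcd (cyc₃⇒cyc₄ (cyc₄-abd (cyc₃⇒cyc₄ (cyc₄⇒cyc₃ cpdr) cda)) cab)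
      cpar : CyclicallyOrdered4 c p a r
      cpar = cyc₄-rotate⁻¹ (cyc₃⇒cyc₄ (cyc₃-trans pab pbr) (cyc₄-acd (cyc₄-rotate cpdr)))
    b-on-c-side : Cyc₃ p r b → ⊥
    b-on-c-side prb = crossing⁻ ∣Iac∣≡∣J∣ wsac drbp (d∈J , d∉Iac) r∈₁ b∉Iac p∈₁ λ b∉J → J∖Iac⊆⁅d⁆ noCommon b∉J
      where
      drbp : CyclicallyOrdered4 d r b p
      drbp = cyc₄-rotate (cyc₃⇒cyc₄ (cyc₄⇒cyc₃ (cyc₄-rotate cpdr)) prb)

  ¬alt-cpdr : c ∈ J → d ∈ J → p ∈ Iab ∖ J → r ∈ Iab ∖ J → CyclicallyOrdered4 c p d r → ⊥
  ¬alt-cpdr {p} c∈J d∈J (p∈Iab , p∉J) (r∈Iab , r∉J) cpdr =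
    [ (λ r∈H → ¬alt-cpdr-inside c∈J d∈J p∈H p∉J r∈H r∉J cpdr)
    , [ (λ { refl → ¬alt-cpd-a∨b c∈J d∈J p∈H p∉J cpd (inj₁ r∉J) })
      , (λ { refl → ¬alt-cpd-a∨b c∈J d∈J p∈H p∉J cpd (inj₂ r∉J) }) ]′ ]′ (∈⊕⁻ r∈Iab)
    where
    cpd : Cyc₃ c p d
    cpd = cyc₄⇒cyc₃ cpdr
    p∈H : p ∈ H
    p∈H = ∈Iab-between-c-d⇒∈H p∈Iab cpd

  ¬alt-bqpd : b ∉ J → d ∈ J → p ∈ Iab ∖ J → q ∈ J ∖ Iab → CyclicallyOrdered4 b q p d → ⊥
  ¬alt-bqpd {p} {q} b∉J d∈J p∈@(p∈Iab , p∉J) q∈ bqpd = by-membership-of-a (a ∈? J)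
    where
    bpd : Cyc₃ b p d
    bpd = cyc₄-acd bqpd
    bqpa : CyclicallyOrdered4 b q p a
    bqpa = cyc₃⇒cyc₄ (cyc₄⇒cyc₃ bqpd) (cyc₃-trans bpd bda)
    p≢a : p ≢ a
    p≢a refl = cyc₃-asym bda bpd
    p∈H : p ∈ H
    p∈H = ∈⊕⇒∈base p∈Iab p≢a (≢-sym (cyc₃⇒≢ bpd))
    p∈₁ : p ∈ Iac ∖ J
    p∈₁ = ∈⊕-base p∈H , p∉J
    p∈₂ : p ∈ Ibd ∖ J
    p∈₂ = ∈⊕-base p∈H , p∉J
    q∈₂ : q ∈ J ∖ Ibd
    q∈₂ = J∖Iab⇒J∖Ibd q∈ (cyc₃⇒≢ (cyc₄-acd (cyc₄-rotate bqpd)))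
    by-membership-of-a : Dec (a ∈ J) → ⊥
    by-membership-of-a (yes a∈J) = ¬alternation wsbd bqpa (∈⊕-left , b∉J) q∈₂ p∈₂ (a∈J , a∉Ibd)
    by-membership-of-a (no a∉J)  = p≢a (∖-unique (sym ∣Iac∣≡∣J∣) (J∖Iac⊆⁅d⁆ noCommon b∉J) p∈₁ (∈⊕-left , a∉J))
      where
      noCommon : NoCommonMinus
      noCommon = squeeze₅′ wsac wsbd (cyc₄-rotate⁻¹ bqpa) (cyc₄-acd (cyc₄-rotate⁻¹ (cyc₃⇒cyc₄ bpd bda)))
                   (∈⊕-left , a∉J) (∈⊕-left , b∉J) q∈₂ p∈₁ p∈₂ (d∈J , d∉Iac)

  ¬alt-bdpq : b ∉ J → d ∈ J → p ∈ Iab ∖ J → q ∈ J ∖ Iab → CyclicallyOrdered4 b d p q → ⊥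
  ¬alt-bdpq {p} {q} b∉J d∈J p∈ q∈ bdpq = by-membership-of-c (c ∈? J)
    where
    bdq : Cyc₃ b d q
    bdq = cyc₄-abd bdpq
    pbcd : CyclicallyOrdered4 p b c d
    pbcd = cyc₄-rotate⁻¹ (cyc₃⇒cyc₄ bcd (cyc₄⇒cyc₃ bdpq))
    pqbc : CyclicallyOrdered4 p q b c
    pqbc = cyc₃⇒cyc₄ (cyc₄⇒cyc₃ (cyc₄-rotate² bdpq)) (cyc₄⇒cyc₃ pbcd)
    q≢c : q ≢ c
    q≢c refl = cyc₃-asym bcd bdq
    p∈₁ : p ∈ Iac ∖ J
    p∈₁ = Iab∖J⇒Iac∖J p∈ (≢-sym (cyc₃⇒≢ (cyc₄-acd bdpq)))
    q∈₁ : q ∈ J ∖ Iac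
    q∈₁ = J∖Iab⇒J∖Iac q∈ q≢c
    q∈₂ : q ∈ J ∖ Ibd
    q∈₂ = J∖Iab⇒J∖Ibd q∈ (≢-sym (cyc₃⇒≢ (cyc₃-rotate bdq)))
    by-membership-of-c : Dec (c ∈ J) → ⊥
    by-membership-of-c (no c∉J)  =
      ¬alternation wsac (cyc₃⇒cyc₄ (cyc₄-abd pqbc) (cyc₄-acd pbcd)) p∈₁ q∈₁ (∈⊕-right , c∉J) (d∈J , d∉Iac)
    by-membership-of-c (yes c∈J) = q≢c (∖-unique ∣Ibd∣≡∣J∣ (Ibd∖J⊆⁅b⁆ noCommon d∈J) q∈₂ (c∈J , c∉Ibd))
      where
      noCommon : NoCommonPlus
      noCommon = squeeze₅ wsac wsbd pqbc (cyc₄-acd pbcd) p∈₁ q∈₁ q∈₂ (∈⊕-left , b∉J) (c∈J , c∉Ibd) (d∈J , d∉Iac)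

  ¬alt-acpq : a ∉ J → c ∈ J → p ∈ Iab ∖ J → q ∈ J ∖ Iab → CyclicallyOrdered4 a c p q → ⊥
  ¬alt-acpq {p} {q} a∉J c∈J p∈@(p∈Iab , p∉J) q∈ acpq = by-membership-of-b (b ∈? J)
    where
    acp : Cyc₃ a c p
    acp = cyc₄⇒cyc₃ acpq
    p≢b : p ≢ b
    p≢b refl = cyc₃-asym abc acp
    p∈H : p ∈ H
    p∈H = ∈⊕⇒∈base p∈Iab (≢-sym (cyc₃⇒≢ (cyc₄-acd acpq))) p≢b
    p∈₁ : p ∈ Iac ∖ J
    p∈₁ = ∈⊕-base p∈H , p∉J
    p∈₂ : p ∈ Ibd ∖ J
    p∈₂ = ∈⊕-base p∈H , p∉J
    q∈₁ : q ∈ J ∖ Iac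
    q∈₁ = J∖Iab⇒J∖Iac q∈ (≢-sym (cyc₃⇒≢ (cyc₄-acd (cyc₄-rotate acpq))))
    by-membership-of-b : Dec (b ∈ J) → ⊥
    by-membership-of-b (yes b∈J) =
      ¬alternation wsac (cyc₃⇒cyc₄ (cyc₃-trans abc acp) (cyc₄-acd acpq)) (∈⊕-left , a∉J) (b∈J , b∉Iac) p∈₁ q∈₁
    by-membership-of-b (no b∉J)  = p≢b (∖-unique (sym ∣Ibd∣≡∣J∣) (J∖Ibd⊆⁅c⁆ noCommon a∉J) p∈₂ (∈⊕-left , b∉J))
      where
      noCommon : NoCommonMinus
      noCommon = squeeze₅′ wsac wsbd (cyc₃⇒cyc₄ abc acp) (cyc₄-acd acpq)
                   (∈⊕-left , a∉J) (∈⊕-left , b∉J) (c∈J , c∉Ibd) p∈₁ p∈₂ q∈₁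

  ¬alt-aqpc : a ∉ J → c ∈ J → p ∈ Iab ∖ J → q ∈ J ∖ Iab → CyclicallyOrdered4 a q p c → ⊥
  ¬alt-aqpc {p} {q} a∉J c∈J p∈ q∈ aqpc = by-membership-of-d (d ∈? J)
    where
    aqc : Cyc₃ a q c
    aqc = cyc₄-abd aqpc
    pcda : CyclicallyOrdered4 p c d a
    pcda = cyc₄-rotate (cyc₃⇒cyc₄ (cyc₄-acd aqpc) acd)
    q≢d : q ≢ d
    q≢d refl = cyc₃-asym acd aqc
    p∈₂ : p ∈ Ibd ∖ J
    p∈₂ = Iab∖J⇒Ibd∖J p∈ (≢-sym (cyc₃⇒≢ (cyc₄-acd aqpc)))
    q∈₁ : q ∈ J ∖ Iac
    q∈₁ = J∖Iab⇒J∖Iac q∈ (cyc₃⇒≢ (cyc₄-acd (cyc₄-rotate aqpc)))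
    q∈₂ : q ∈ J ∖ Ibd
    q∈₂ = J∖Iab⇒J∖Ibd q∈ q≢d
    by-membership-of-d : Dec (d ∈ J) → ⊥
    by-membership-of-d (no d∉J)  =
      ¬alternation wsbd pcdq p∈₂ (c∈J , c∉Ibd) (∈⊕-right , d∉J) q∈₂
      where
      pcdq : CyclicallyOrdered4 p c d q
      pcdq = cyc₃⇒cyc₄ (cyc₄⇒cyc₃ pcda) (cyc₃-trans (cyc₄-acd pcda) (cyc₃-rotate⁻¹ (cyc₄⇒cyc₃ aqpc)))
    by-membership-of-d (yes d∈J) = q≢d (∖-unique ∣Iac∣≡∣J∣ (Iac∖J⊆⁅a⁆ noCommon c∈J) q∈₁ (d∈J , d∉Iac))
      where
      noCommon : NoCommonPlus
      noCommon = squeeze₅ wsac wsbd aqpc acd (∈⊕-left , a∉J) q∈₁ q∈₂ p∈₂ (c∈J , c∉Ibd) (d∈J , d∉Iac)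

  Iab-separated : WeaklySeparated Iab J
  Iab-separated (p , q , r , s , pqrs , p∈ , r∈ , q∈ , s∈)
    with p ≟ b | r ≟ b | q ≟ c | s ≟ c | p ≟ a | r ≟ a | q ≟ d | s ≟ d
  ... | no p≢b | no r≢b | no q≢c | no s≢c | _ | _ | _ | _ =
    ¬alternation wsac pqrs (Iab∖J⇒Iac∖J p∈ p≢b) (J∖Iab⇒J∖Iac q∈ q≢c) (Iab∖J⇒Iac∖J r∈ r≢b) (J∖Iab⇒J∖Iac s∈ s≢c)
  ... | _ | _ | _ | _ | no p≢a | no r≢a | no q≢d | no s≢d =
    ¬alternation wsbd pqrs (Iab∖J⇒Ibd∖J p∈ p≢a) (J∖Iab⇒J∖Ibd q∈ q≢d) (Iab∖J⇒Ibd∖J r∈ r≢a) (J∖Iab⇒J∖Ibd s∈ s≢d)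
  ... | yes refl | _ | _ | _ | _ | yes refl | _ | _ = ¬alt-aqbs (proj₂ r∈) (proj₂ p∈) s∈ q∈ (cyc₄-rotate² pqrs)
  ... | yes refl | _ | _ | _ | _ | _ | yes refl | _ = ¬alt-bdpq (proj₂ p∈) (proj₁ q∈) r∈ s∈ pqrs
  ... | yes refl | _ | _ | _ | _ | _ | _ | yes refl = ¬alt-bqpd (proj₂ p∈) (proj₁ s∈) r∈ q∈ pqrs
  ... | yes p≡b | _ | _ | _ | yes p≡a | _ | _ | _ = a≢b (trans (sym p≡a) p≡b)
  ... | _ | yes refl | _ | _ | yes refl | _ | _ | _ = ¬alt-aqbs (proj₂ p∈) (proj₂ r∈) q∈ s∈ pqrs
  ... | _ | yes refl | _ | _ | _ | _ | yes refl | _ = ¬alt-bqpd (proj₂ r∈) (proj₁ q∈) p∈ s∈ (cyc₄-rotate² pqrs)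
  ... | _ | yes refl | _ | _ | _ | _ | _ | yes refl = ¬alt-bdpq (proj₂ r∈) (proj₁ s∈) p∈ q∈ (cyc₄-rotate² pqrs)
  ... | _ | yes r≡b | _ | _ | _ | yes r≡a | _ | _ = a≢b (trans (sym r≡a) r≡b)
  ... | _ | _ | yes refl | _ | yes refl | _ | _ | _ = ¬alt-acpq (proj₂ p∈) (proj₁ q∈) r∈ s∈ pqrs
  ... | _ | _ | yes refl | _ | _ | yes refl | _ | _ = ¬alt-aqpc (proj₂ r∈) (proj₁ q∈) p∈ s∈ (cyc₄-rotate² pqrs)
  ... | _ | _ | yes refl | _ | _ | _ | _ | yes refl = ¬alt-cpdr (proj₁ q∈) (proj₁ s∈) r∈ p∈ (cyc₄-rotate pqrs)
  ... | _ | _ | yes q≡c | _ | _ | _ | yes q≡d | _ = c≢d (trans (sym q≡c) q≡d)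
  ... | _ | _ | _ | yes refl | yes refl | _ | _ | _ = ¬alt-aqpc (proj₂ p∈) (proj₁ s∈) r∈ q∈ pqrs
  ... | _ | _ | _ | yes refl | _ | yes refl | _ | _ = ¬alt-acpq (proj₂ r∈) (proj₁ s∈) p∈ q∈ (cyc₄-rotate² pqrs)
  ... | _ | _ | _ | yes refl | _ | _ | yes refl | _ = ¬alt-cpdr (proj₁ s∈) (proj₁ q∈) p∈ r∈ (cyc₄-rotate⁻¹ pqrs)
  ... | _ | _ | _ | yes s≡c | _ | _ | _ | yes s≡d = c≢d (trans (sym s≡c) s≡d)

mainTheorem2 : (n k : ℕ) → 1 ≤ k → k ≤ n →
    (H : Subset n) → ∣ H ∣ + 2 ≡ k →
    (a b c d : Fin n) → a ∉ H → b ∉ H → c ∉ H → d ∉ H →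
    CyclicallyOrdered4 a b c d →
    (J : Subset n) → ∣ J ∣ ≡ k →
    WeaklySeparated (H ⊕ a , c) J → WeaklySeparated (H ⊕ b , d) J →
    WeaklySeparated (H ⊕ a , b) J × WeaklySeparated (H ⊕ b , c) J
      × WeaklySeparated (H ⊕ c , d) J × WeaklySeparated (H ⊕ d , a) J
mainTheorem2 n k _ _ H ∣H∣+2≡k a b c d a∉H b∉H c∉H d∉H abcd J ∣J∣≡k wsac wsbd =
    Exchange.Iab-separated H J ∣H∣+2≡∣J∣ a∉H b∉H c∉H d∉H abcd wsac wsbd
  , Exchange.Iab-separated H J ∣H∣+2≡∣J∣ b∉H c∉H d∉H a∉H (cyc₄-rotate abcd) wsbd (ws-⊕-comm wsac)
  , Exchange.Iab-separated H J ∣H∣+2≡∣J∣ c∉H d∉H a∉H b∉H (cyc₄-rotate² abcd)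
      (ws-⊕-comm wsac) (ws-⊕-comm wsbd)
  , Exchange.Iab-separated H J ∣H∣+2≡∣J∣ d∉H a∉H b∉H c∉H (cyc₄-rotate⁻¹ abcd) (ws-⊕-comm wsbd) wsac
  where
  ∣H∣+2≡∣J∣ : ∣ H ∣ + 2 ≡ ∣ J ∣
  ∣H∣+2≡∣J∣ = trans ∣H∣+2≡k (sym ∣J∣≡k)
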